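{- Let $q\geq 3$ be a prime power and $d\leq e$ positive integers. Let $0\leq i\leq d$, $1\leq j\leq d$, $h_{\max}=\min\{j,d-i\}$ and $s=b_{h_{\max}}(i,j)$, where $$b_h(i,j)=-\tfrac12 h^2+\left(e-i+\tfrac12\right)h+j\left(d-\tfrac{j+1}{2}\right).$$ Then $\frac14 q^s<|B_j(i)|<2q^s$, where $B_j(i)=\sum_{h=0}^{j}(-1)^{j-h}q^{eh+\binom{j-h}{2}}{d-h \brack d-j}_q{d-i \brack h}_q$.
   Context: For integers $N\geq 0$ and $k$, ${N \brack k}_q=\prod_{t=1}^{k}\frac{q^{N-k+t}-1}{q^t-1}$ if $0\leq k\leq N$, and $0$ if $k<0$ or $k>N$. $B_j(i)$ is the $i$-th eigenvalue of the bilinear forms graph $H_q(d,e,j)$. -}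

module Defs where

open import Data.Nat using (ℕ; zero; suc; _+_; _*_; _∸_; _^_; _≤_; _<_; _≤?_; _⊓_; _/_)
open import Data.Nat.Combinatorics using (_C_)
open import Data.Integer using (ℤ; +_; -[1+_]) renaming (_+_ to _+ℤ_; _*_ to _*ℤ_; _^_ to _^ℤ_)
open import Relation.Nullary using (yes; no)
open import Data.Product using (Σ; _×_)
open import Data.Nat.Primality using (Prime)
open import Relation.Binary.PropositionalEquality using (_≡_)

prod1 : (ℕ → ℕ) → ℕ → ℕ
prod1 f zero = 1
prod1 f (suc k) = prod1 f k * f (suc k)

sumℤ0 : (ℕ → ℤ) → ℕ → ℤ
sumℤ0 f zero = f 0
sumℤ0 f (suc n) = sumℤ0 f n +ℤ f (suc n)

-- exact division of naturals; the divisor is never 0 in our use (q ≥ 2)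
_div_ : ℕ → ℕ → ℕ
m div zero = 0
m div (suc n) = m / suc n

gauss : ℕ → ℕ → ℕ → ℕ
gauss q N k with k ≤? N
... | yes _ = prod1 (λ t → q ^ (N ∸ k + t) ∸ 1) k div prod1 (λ t → q ^ t ∸ 1) k
... | no _ = 0

B : (q d e j i : ℕ) → ℤ
B q d e j i = sumℤ0 (λ h → (-[1+ 0 ] ^ℤ (j ∸ h)) *ℤ
                           (+ (q ^ (e * h + (j ∸ h) C 2) * gauss q (d ∸ h) (d ∸ j) * gauss q (d ∸ i) h))) j

hmax : (d i j : ℕ) → ℕ
hmax d i j = j ⊓ (d ∸ i)

-- b_h(i,j) = -h²/2 + (e-i+1/2)h + j(d-(j+1)/2) = h(2(e-i)+1-h)/2 + j(2d-j-1)/2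
-- (both summands are exact nonnegative integers when h ≤ e-i and 1 ≤ j ≤ d)
b : (d e h i j : ℕ) → ℕ
b d e h i j = (h * (2 * (e ∸ i) + 1 ∸ h)) / 2 + (j * (2 * d ∸ j ∸ 1)) / 2

IsPrimePower : ℕ → Set
IsPrimePower q = Σ ℕ λ p → Σ ℕ λ m → Prime p × (1 ≤ m × q ≡ p ^ m)

-- Write B_j(i) as the alternating sum of T_h = q^(eh + C(j-h,2)) [d-h, d-j]_q [d-i, h]_q over h ≤ j.
-- For q ≥ 3 a Gaussian binomial [n, k]_q lies in [q^(k(n-k)), 2 q^(k(n-k))), because the product of the
-- factors q^t / (q^t - 1) stays below 2.  The ratio identities of Gaussian binomials show that T_(h+1) / T_h
-- exceeds 4/3 for h < h_max, while T_h = 0 for h > d - i ≥ h_max; an alternating sum of such terms lies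
-- between T_(h_max) / 4 and T_(h_max).  At h = h_max one of the two Gaussian binomials equals 1 and the
-- exponent of the remaining bracket works out to b_(h_max)(i, j).
module Submission where

open import Defs
open import Data.Nat
open import Data.Nat.Properties
open import Data.Nat.DivMod using (m*n/n≡m)
open import Data.Nat.Combinatorics using (_C_; nCk+nC[k+1]≡[n+1]C[k+1]; nC1≡n)
open import Data.Nat.Tactic.RingSolver using (solve-∀)
open import Data.Integer as ℤ using (ℤ; ∣_∣; -[1+_])
import Data.Integer.Properties as ℤ
import Data.Integer.Tactic.RingSolver as ℤ-Solver
open import Data.Product using (_×_; _,_; proj₁; proj₂)
open import Data.Sum using (inj₁; inj₂)
open import Function using (_∘_)
open import Relation.Binary.PropositionalEquality
open import Relation.Nullary using (yes; no)
open import Relation.Nullary.Negation using (contradiction)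

private variable
  k n : ℕ

m*n-div-n≡m : ∀ m {n} → 0 < n → (m * n) div n ≡ m
m*n-div-n≡m m {suc n} _ = m*n/n≡m m (suc n)

pred+*pred≡*pred : ∀ x z → 0 < x → 0 < z → (x ∸ 1) + x * (z ∸ 1) ≡ x * z ∸ 1
pred+*pred≡*pred (suc x) (suc z) _ _ = identity x z
  where
  identity : ∀ x z → x + suc x * z ≡ z + x * suc z
  identity = solve-∀

prod1-cong : ∀ {f g} → (∀ t → f t ≡ g t) → ∀ k → prod1 f k ≡ prod1 g k
prod1-cong f≗g zero    = refl
prod1-cong f≗g (suc k) = cong₂ _*_ (prod1-cong f≗g k) (f≗g (suc k))

prod1-unshift : ∀ f k → prod1 f (suc k) ≡ f 1 * prod1 (f ∘ suc) k
prod1-unshift f zero    = *-comm 1 (f 1)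
prod1-unshift f (suc k) = trans (cong (_* f (2 + k)) (prod1-unshift f k)) (*-assoc (f 1) _ _)

x*[X+1]≤[x+1]*[X∸1] : ∀ {x X} → 0 < x → 3 * x ≤ X → x * (X + 1) ≤ (x + 1) * (X ∸ 1)
x*[X+1]≤[x+1]*[X∸1] {x} {zero}  0<x 3x≤0   = contradiction (≤-trans (m≤m+n x (2 * x)) 3x≤0) (<⇒≱ 0<x)
x*[X+1]≤[x+1]*[X∸1] {x} {suc Y} 0<x 3x≤1+Y = begin
  x * (suc Y + 1) ≡⟨ expand x Y ⟩
  x * Y + 2 * x   ≤⟨ +-monoʳ-≤ (x * Y) (≤-pred (≤-trans (+-monoˡ-≤ (2 * x) 0<x) 3x≤1+Y)) ⟩
  x * Y + Y       ≡⟨ factor x Y ⟩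
  (x + 1) * Y     ∎
  where
  open ≤-Reasoning
  expand : ∀ x Y → x * (suc Y + 1) ≡ x * Y + 2 * x
  expand = solve-∀
  factor : ∀ x Y → x * Y + Y ≡ (x + 1) * Y
  factor = solve-∀

[1+n]C2≡n+nC2 : ∀ n → suc n C 2 ≡ n + n C 2
[1+n]C2≡n+nC2 n = trans (sym (nCk+nC[k+1]≡[n+1]C[k+1] n 1)) (cong (_+ n C 2) (nC1≡n n))

[1+n]C2+nC2≡n*n : ∀ n → suc n C 2 + n C 2 ≡ n * n
[1+n]C2+nC2≡n*n zero    = refl
[1+n]C2+nC2≡n*n (suc n) = begin
  suc (suc n) C 2 + suc n C 2       ≡⟨ cong₂ _+_ ([1+n]C2≡n+nC2 (suc n)) ([1+n]C2≡n+nC2 n) ⟩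
  (suc n + suc n C 2) + (n + n C 2) ≡⟨ rearrange (suc n) n (suc n C 2) (n C 2) ⟩
  suc n + n + (suc n C 2 + n C 2)   ≡⟨ cong (suc n + n +_) ([1+n]C2+nC2≡n*n n) ⟩
  suc n + n + n * n                 ≡⟨ square n ⟩
  suc n * suc n                     ∎
  where
  open ≡-Reasoning
  rearrange : ∀ a b x y → (a + x) + (b + y) ≡ a + b + (x + y)
  rearrange = solve-∀
  square : ∀ n → suc n + n + n * n ≡ suc n * suc n
  square = solve-∀

[1+n]C2*2≡n*[1+n] : ∀ n → (suc n C 2) * 2 ≡ n * suc n
[1+n]C2*2≡n*[1+n] n = begin
  (suc n C 2) * 2               ≡⟨ double (suc n C 2) ⟩
  suc n C 2 + suc n C 2         ≡⟨ cong (suc n C 2 +_) ([1+n]C2≡n+nC2 n) ⟩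
  suc n C 2 + (n + n C 2)       ≡⟨ rearrange n (suc n C 2) (n C 2) ⟩
  n + (suc n C 2 + n C 2)       ≡⟨ cong (n +_) ([1+n]C2+nC2≡n*n n) ⟩
  n + n * n                     ≡⟨ sym (*-suc n n) ⟩
  n * suc n                     ∎
  where
  open ≡-Reasoning
  double : ∀ x → x * 2 ≡ x + x
  double = solve-∀
  rearrange : ∀ n x y → x + (n + y) ≡ n + (x + y)
  rearrange = solve-∀

[m+n]C2 : ∀ m n → (m + n) C 2 ≡ m C 2 + n C 2 + m * n
[m+n]C2 zero    n = sym (+-identityʳ (n C 2))
[m+n]C2 (suc m) n = begin
  suc (m + n) C 2                        ≡⟨ [1+n]C2≡n+nC2 (m + n) ⟩
  m + n + (m + n) C 2                    ≡⟨ cong (m + n +_) ([m+n]C2 m n) ⟩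
  m + n + (m C 2 + n C 2 + m * n)        ≡⟨ rearrange m n (m C 2) (n C 2) ⟩
  m + m C 2 + n C 2 + suc m * n          ≡⟨ cong (λ x → x + n C 2 + suc m * n) (sym ([1+n]C2≡n+nC2 m)) ⟩
  suc m C 2 + n C 2 + suc m * n          ∎
  where
  open ≡-Reasoning
  rearrange : ∀ m n x y → m + n + (x + y + m * n) ≡ m + x + y + suc m * n
  rearrange = solve-∀

x≡y*2⇒x/2≡y : ∀ {x} y → x ≡ y * 2 → x / 2 ≡ y
x≡y*2⇒x/2≡y y refl = m*n/n≡m y 2

b≡ : ∀ {d e h i j} w r → e ∸ i ≡ h + w → d ≡ j + r → 0 < j →
     b d e h i j ≡ suc h C 2 + h * w + (j C 2 + j * r)
b≡ {d} {e} {h} {i} {suc j} w r e∸i≡h+w refl _ = cong₂ _+_ first-half second-half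
  where
  open ≡-Reasoning
  first-half : h * (2 * (e ∸ i) + 1 ∸ h) / 2 ≡ suc h C 2 + h * w
  first-half = x≡y*2⇒x/2≡y _ (begin
    h * (2 * (e ∸ i) + 1 ∸ h)         ≡⟨ cong (λ x → h * (2 * x + 1 ∸ h)) e∸i≡h+w ⟩
    h * (2 * (h + w) + 1 ∸ h)         ≡⟨ cong (λ x → h * (x ∸ h)) (split h w) ⟩
    h * (h + (h + 2 * w + 1) ∸ h)     ≡⟨ cong (h *_) (m+n∸m≡n h (h + 2 * w + 1)) ⟩
    h * (h + 2 * w + 1)               ≡⟨ expand h w ⟩
    h * suc h + h * w * 2             ≡⟨ cong (_+ h * w * 2) (sym ([1+n]C2*2≡n*[1+n] h)) ⟩
    (suc h C 2) * 2 + h * w * 2       ≡⟨ sym (*-distribʳ-+ 2 (suc h C 2) (h * w)) ⟩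
    (suc h C 2 + h * w) * 2           ∎)
    where
    split : ∀ h w → 2 * (h + w) + 1 ≡ h + (h + 2 * w + 1)
    split = solve-∀
    expand : ∀ h w → h * (h + 2 * w + 1) ≡ h * suc h + h * w * 2
    expand = solve-∀
  second-half : suc j * (2 * (suc j + r) ∸ suc j ∸ 1) / 2 ≡ suc j C 2 + suc j * r
  second-half = x≡y*2⇒x/2≡y _ (begin
    suc j * (2 * (suc j + r) ∸ suc j ∸ 1)         ≡⟨ cong (λ x → suc j * (x ∸ suc j ∸ 1)) (split j r) ⟩
    suc j * (suc j + suc (j + 2 * r) ∸ suc j ∸ 1) ≡⟨ cong (λ x → suc j * (x ∸ 1)) (m+n∸m≡n (suc j) (suc (j + 2 * r))) ⟩
    suc j * (j + 2 * r)                           ≡⟨ expand j r ⟩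
    j * suc j + suc j * r * 2                     ≡⟨ cong (_+ suc j * r * 2) (sym ([1+n]C2*2≡n*[1+n] j)) ⟩
    (suc j C 2) * 2 + suc j * r * 2               ≡⟨ sym (*-distribʳ-+ 2 (suc j C 2) (suc j * r)) ⟩
    (suc j C 2 + suc j * r) * 2                   ∎)
    where
    split : ∀ j r → 2 * (suc j + r) ≡ suc j + suc (j + 2 * r)
    split = solve-∀
    expand : ∀ j r → suc j * (j + 2 * r) ≡ j * suc j + suc j * r * 2
    expand = solve-∀

exponent-at-j : ∀ {d e i j} → i ≤ d → d ≤ e → 0 < j → j ≤ d ∸ i →
                e * j + (j ∸ j) C 2 + j * (d ∸ i ∸ j) ≡ b d e j i j
exponent-at-j {d} {e} {i} {j} i≤d d≤e 0<j j≤d∸i = begin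
  e * j + (j ∸ j) C 2 + j * c                      ≡⟨ cong (λ x → e * j + x C 2 + j * c) (n∸n≡0 j) ⟩
  e * j + 0 + j * c                                ≡⟨ cong (λ x → x * j + 0 + j * c) e≡f+[c+j+i] ⟩
  (f + (c + j + i)) * j + 0 + j * c                ≡⟨ expand f c j i ⟩
  j * j + j * (c + f) + j * (i + c)                ≡⟨ cong (λ x → x + j * (c + f) + j * (i + c)) (sym ([1+n]C2+nC2≡n*n j)) ⟩
  suc j C 2 + j C 2 + j * (c + f) + j * (i + c)    ≡⟨ rearrange (suc j C 2) (j C 2) (j * (c + f)) (j * (i + c)) ⟩
  suc j C 2 + j * (c + f) + (j C 2 + j * (i + c))  ≡⟨ sym (b≡ {e = e} {h = j} {i = i} (c + f) (i + c) e∸i≡j+[c+f] d≡j+[i+c] 0<j) ⟩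
  b d e j i j                                      ∎
  where
  open ≡-Reasoning
  c f : ℕ
  c = d ∸ i ∸ j
  f = e ∸ d
  d≡c+j+i : d ≡ c + j + i
  d≡c+j+i = sym (trans (cong (_+ i) (m∸n+n≡m j≤d∸i)) (m∸n+n≡m i≤d))
  e≡f+[c+j+i] : e ≡ f + (c + j + i)
  e≡f+[c+j+i] = trans (sym (m∸n+n≡m d≤e)) (cong (f +_) d≡c+j+i)
  e∸i≡j+[c+f] : e ∸ i ≡ j + (c + f)
  e∸i≡j+[c+f] = trans (cong (_∸ i) (trans e≡f+[c+j+i] (regroup f c j i))) (m+n∸n≡m (j + (c + f)) i)
    where
    regroup : ∀ f c j i → f + (c + j + i) ≡ j + (c + f) + i
    regroup = solve-∀
  d≡j+[i+c] : d ≡ j + (i + c)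
  d≡j+[i+c] = trans d≡c+j+i (regroup c j i)
    where
    regroup : ∀ c j i → c + j + i ≡ j + (i + c)
    regroup = solve-∀
  expand : ∀ f c j i → (f + (c + j + i)) * j + 0 + j * c ≡ j * j + j * (c + f) + j * (i + c)
  expand = solve-∀
  rearrange : ∀ x y u v → x + y + u + v ≡ x + u + (y + v)
  rearrange = solve-∀

exponent-at-d∸i : ∀ {d e i j} → i ≤ d → d ≤ e → j ≤ d → d ∸ i < j →
                  e * (d ∸ i) + (j ∸ (d ∸ i)) C 2 + (d ∸ j) * (d ∸ (d ∸ i) ∸ (d ∸ j)) ≡ b d e (d ∸ i) i j
exponent-at-d∸i {d} {e} {i} {j} i≤d d≤e j≤d m<j = begin
  e * m + s C 2 + p * (d ∸ m ∸ p)                               ≡⟨ cong (λ x → e * m + s C 2 + p * (x ∸ p)) (m∸[m∸n]≡n i≤d) ⟩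
  e * m + s C 2 + p * (i ∸ p)                                   ≡⟨ cong (λ x → e * m + s C 2 + p * (x ∸ p)) i≡s+p ⟩
  e * m + s C 2 + p * (s + p ∸ p)                               ≡⟨ cong (λ x → e * m + s C 2 + p * x) (m+n∸n≡m s p) ⟩
  e * m + s C 2 + p * s                                         ≡⟨ cong (λ x → x * m + s C 2 + p * s) e≡f+[m+s+p] ⟩
  (f + (m + s + p)) * m + s C 2 + p * s                         ≡⟨ expand f m s p (s C 2) ⟩
  m * m + m * f + (s C 2 + m * s + (m + s) * p)                 ≡⟨ cong (λ x → x + m * f + (s C 2 + m * s + (m + s) * p)) (sym ([1+n]C2+nC2≡n*n m)) ⟩
  suc m C 2 + m C 2 + m * f + (s C 2 + m * s + (m + s) * p)     ≡⟨ rearrange (suc m C 2) (m C 2) (m * f) (s C 2) (m * s) ((m + s) * p) ⟩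
  suc m C 2 + m * f + (m C 2 + s C 2 + m * s + (m + s) * p)     ≡⟨ cong (λ x → suc m C 2 + m * f + (x + (m + s) * p)) (sym ([m+n]C2 m s)) ⟩
  suc m C 2 + m * f + ((m + s) C 2 + (m + s) * p)               ≡⟨ cong (λ x → suc m C 2 + m * f + (x C 2 + x * p)) (sym j≡m+s) ⟩
  suc m C 2 + m * f + (j C 2 + j * p)                           ≡⟨ sym (b≡ {e = e} {h = m} {i = i} f p e∸i≡m+f d≡j+p (≤-<-trans z≤n m<j)) ⟩
  b d e m i j                                                   ∎
  where
  open ≡-Reasoning
  m s p f : ℕ
  m = d ∸ i
  s = j ∸ m
  p = d ∸ j
  f = e ∸ d
  j≡m+s : j ≡ m + s
  j≡m+s = sym (m+[n∸m]≡n (<⇒≤ m<j))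
  d≡j+p : d ≡ j + p
  d≡j+p = sym (m+[n∸m]≡n j≤d)
  d≡m+i : d ≡ m + i
  d≡m+i = sym (m∸n+n≡m i≤d)
  i≡s+p : i ≡ s + p
  i≡s+p = +-cancelˡ-≡ m i (s + p) (trans (sym d≡m+i) (trans d≡j+p (trans (cong (_+ p) j≡m+s) (+-assoc m s p))))
  e≡f+[m+s+p] : e ≡ f + (m + s + p)
  e≡f+[m+s+p] = trans (sym (m∸n+n≡m d≤e)) (cong (f +_) (trans d≡j+p (cong (_+ p) j≡m+s)))
  e∸i≡m+f : e ∸ i ≡ m + f
  e∸i≡m+f = trans (cong (_∸ i) (trans (sym (m∸n+n≡m d≤e)) (trans (cong (f +_) d≡m+i) (regroup f m i)))) (m+n∸n≡m (m + f) i)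
    where
    regroup : ∀ f m i → f + (m + i) ≡ m + f + i
    regroup = solve-∀
  expand : ∀ f m s p y → (f + (m + s + p)) * m + y + p * s ≡ m * m + m * f + (y + m * s + (m + s) * p)
  expand = solve-∀
  rearrange : ∀ x y u z v w → x + y + u + (z + v + w) ≡ x + u + (y + z + v + w)
  rearrange = solve-∀

d∸k∸[d∸j]≡j∸k : ∀ {d j k} → k ≤ j → j ≤ d → d ∸ k ∸ (d ∸ j) ≡ j ∸ k
d∸k∸[d∸j]≡j∸k {d} {j} {k} k≤j j≤d = begin
  d ∸ k ∸ (d ∸ j)                   ≡⟨ cong (λ x → x ∸ k ∸ (d ∸ j)) (sym (m∸n+n≡m j≤d)) ⟩
  d ∸ j + j ∸ k ∸ (d ∸ j)           ≡⟨ cong (_∸ (d ∸ j)) (+-∸-assoc (d ∸ j) k≤j) ⟩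
  d ∸ j + (j ∸ k) ∸ (d ∸ j)         ≡⟨ m+n∸m≡n (d ∸ j) (j ∸ k) ⟩
  j ∸ k                             ∎
  where open ≡-Reasoning

module GaussianBinomial (q : ℕ) (1<q : 1 < q) where

  instance
    q-nonZero : NonZero q
    q-nonZero = >-nonZero (<-trans z<s 1<q)

  q^n>0 : ∀ n → 0 < q ^ n
  q^n>0 = m^n>0 q

  q^[1+n]∸1>0 : ∀ n → 0 < q ^ suc n ∸ 1
  q^[1+n]∸1>0 n = m<n⇒0<n∸m (<-≤-trans 1<q (m≤m*n q (q ^ n) {{>-nonZero (q^n>0 n)}}))

  PowerBracket : ℕ → ℕ → Set
  PowerBracket s t = q ^ s ≤ t × t < 2 * q ^ s

  q^x*-bracket : ∀ x {y g} → PowerBracket y g → PowerBracket (x + y) (q ^ x * g)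
  q^x*-bracket x {y} {g} (lower , upper) = lower′ , upper′
    where
    open ≤-Reasoning
    lower′ : q ^ (x + y) ≤ q ^ x * g
    lower′ = begin
      q ^ (x + y)    ≡⟨ ^-distribˡ-+-* q x y ⟩
      q ^ x * q ^ y  ≤⟨ *-monoʳ-≤ (q ^ x) lower ⟩
      q ^ x * g      ∎
    upper′ : q ^ x * g < 2 * q ^ (x + y)
    upper′ = begin-strict
      q ^ x * g            <⟨ *-monoʳ-< (q ^ x) {{>-nonZero (q^n>0 x)}} upper ⟩
      q ^ x * (2 * q ^ y)  ≡⟨ x*[2*y]≡2*[x*y] (q ^ x) (q ^ y) ⟩
      2 * (q ^ x * q ^ y)  ≡⟨ cong (2 *_) (sym (^-distribˡ-+-* q x y)) ⟩
      2 * q ^ (x + y)      ∎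
      where
      x*[2*y]≡2*[x*y] : ∀ x y → x * (2 * y) ≡ 2 * (x * y)
      x*[2*y]≡2*[x*y] = solve-∀

  den : ℕ → ℕ
  den = prod1 (λ t → q ^ t ∸ 1)

  num : ℕ → ℕ → ℕ
  num a = prod1 (λ t → q ^ (a + t) ∸ 1)

  qPowProd : ℕ → ℕ
  qPowProd = prod1 (q ^_)

  den>0 : ∀ k → 0 < den k
  den>0 zero    = z<s
  den>0 (suc k) = *-mono-≤ (den>0 k) (q^[1+n]∸1>0 k)

  den-nonZero : ∀ k → NonZero (den k)
  den-nonZero k = >-nonZero (den>0 k)

  num-unshift : ∀ a k → num a (suc k) ≡ (q ^ suc a ∸ 1) * num (suc a) k
  num-unshift a k = trans (prod1-unshift (λ t → q ^ (a + t) ∸ 1) k)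
    (cong₂ _*_ (cong (λ x → q ^ x ∸ 1) (+-comm a 1))
               (prod1-cong (λ t → cong (λ x → q ^ x ∸ 1) (+-suc a t)) k))

  qPascal : ℕ → ℕ → ℕ
  qPascal n       zero    = 1
  qPascal zero    (suc k) = 0
  qPascal (suc n) (suc k) = qPascal n k + q ^ suc k * qPascal n (suc k)

  qPascal-vanish : n < k → qPascal n k ≡ 0
  qPascal-vanish {zero}  {suc k} _ = refl
  qPascal-vanish {suc n} {suc k} (s<s n<k)
    rewrite qPascal-vanish n<k | qPascal-vanish (m<n⇒m<1+n n<k) | *-zeroʳ (q ^ suc k) = refl

  qPascal-diag : ∀ n → qPascal n n ≡ 1
  qPascal-diag zero = refl
  qPascal-diag (suc n) rewrite qPascal-diag n | qPascal-vanish (n<1+n n) | *-zeroʳ (q ^ suc n) = refl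

  qPascal*den≡num : ∀ n k → k ≤ n → qPascal n k * den k ≡ num (n ∸ k) k
  qPascal[1+k]*den≡[q^[n∸k]∸1]*num : ∀ n k → k ≤ n → qPascal n (suc k) * den (suc k) ≡ (q ^ (n ∸ k) ∸ 1) * num (n ∸ k) k

  qPascal*den≡num n       zero    _         = refl
  qPascal*den≡num (suc n) (suc k) (s≤s k≤n) = begin
    (qPascal n k + X * qPascal n (suc k)) * (den k * (X ∸ 1))
      ≡⟨ expand (qPascal n k) (den k) (X ∸ 1) X (qPascal n (suc k)) ⟩
    qPascal n k * den k * (X ∸ 1) + X * (qPascal n (suc k) * den (suc k))
      ≡⟨ cong₂ (λ u v → u * (X ∸ 1) + X * v) (qPascal*den≡num n k k≤n) (qPascal[1+k]*den≡[q^[n∸k]∸1]*num n k k≤n) ⟩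
    N * (X ∸ 1) + X * ((Z ∸ 1) * N)
      ≡⟨ factor N (X ∸ 1) X (Z ∸ 1) ⟩
    N * ((X ∸ 1) + X * (Z ∸ 1))
      ≡⟨ cong (N *_) (pred+*pred≡*pred X Z (q^n>0 (suc k)) (q^n>0 (n ∸ k))) ⟩
    N * (X * Z ∸ 1)
      ≡⟨ cong (λ u → N * (u ∸ 1)) (sym (^-distribˡ-+-* q (suc k) (n ∸ k))) ⟩
    N * (q ^ (suc k + (n ∸ k)) ∸ 1)
      ≡⟨ cong (λ u → N * (q ^ u ∸ 1)) (+-comm (suc k) (n ∸ k)) ⟩
    N * (q ^ (n ∸ k + suc k) ∸ 1) ∎
    where
    open ≡-Reasoning
    X Z N : ℕ
    X = q ^ suc k
    Z = q ^ (n ∸ k)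
    N = num (n ∸ k) k
    expand : ∀ a d y x b → (a + x * b) * (d * y) ≡ a * d * y + x * (b * (d * y))
    expand = solve-∀
    factor : ∀ m y x z → m * y + x * (z * m) ≡ m * (y + x * z)
    factor = solve-∀

  qPascal[1+k]*den≡[q^[n∸k]∸1]*num n k k≤n with m≤n⇒m<n∨m≡n k≤n
  ... | inj₁ k<n = begin
    qPascal n (suc k) * den (suc k)             ≡⟨ qPascal*den≡num n (suc k) k<n ⟩
    num (n ∸ suc k) (suc k)                     ≡⟨ num-unshift (n ∸ suc k) k ⟩
    (q ^ a ∸ 1) * num a k                       ≡⟨ cong (λ a → (q ^ a ∸ 1) * num a k) (sym (+-∸-assoc 1 k<n)) ⟩
    (q ^ (n ∸ k) ∸ 1) * num (n ∸ k) k           ∎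
    where
    open ≡-Reasoning
    a : ℕ
    a = suc (n ∸ suc k)
  ... | inj₂ refl rewrite qPascal-vanish (n<1+n k) | n∸n≡0 k = refl

  gauss≡qPascal : ∀ n k → gauss q n k ≡ qPascal n k
  gauss≡qPascal n k with k ≤? n
  ... | yes k≤n = trans (cong (_div den k) (sym (qPascal*den≡num n k k≤n))) (m*n-div-n≡m (qPascal n k) (den>0 k))
  ... | no  k≰n = sym (qPascal-vanish (≰⇒> k≰n))

  gauss*den≡num : k ≤ n → gauss q n k * den k ≡ num (n ∸ k) k
  gauss*den≡num {k} {n} k≤n = trans (cong (_* den k) (gauss≡qPascal n k)) (qPascal*den≡num n k k≤n)

  gauss-vanish : n < k → gauss q n k ≡ 0
  gauss-vanish {n} {k} n<k = trans (gauss≡qPascal n k) (qPascal-vanish n<k)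

  gauss-diag : ∀ n → gauss q n n ≡ 1
  gauss-diag n = trans (gauss≡qPascal n n) (qPascal-diag n)

  gauss[1+k]-ratio : k ≤ n → gauss q n (suc k) * (q ^ suc k ∸ 1) ≡ gauss q n k * (q ^ (n ∸ k) ∸ 1)
  gauss[1+k]-ratio {k} {n} k≤n = *-cancelʳ-≡ _ _ (den k) {{den-nonZero k}} (begin
    gauss q n (suc k) * (q ^ suc k ∸ 1) * den k   ≡⟨ *-assoc (gauss q n (suc k)) _ _ ⟩
    gauss q n (suc k) * ((q ^ suc k ∸ 1) * den k) ≡⟨ cong (gauss q n (suc k) *_) (*-comm _ (den k)) ⟩
    gauss q n (suc k) * den (suc k)               ≡⟨ cong (_* den (suc k)) (gauss≡qPascal n (suc k)) ⟩
    qPascal n (suc k) * den (suc k)               ≡⟨ qPascal[1+k]*den≡[q^[n∸k]∸1]*num n k k≤n ⟩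
    (q ^ (n ∸ k) ∸ 1) * num (n ∸ k) k             ≡⟨ cong ((q ^ (n ∸ k) ∸ 1) *_) (sym (gauss*den≡num k≤n)) ⟩
    (q ^ (n ∸ k) ∸ 1) * (gauss q n k * den k)     ≡⟨ sym (*-assoc (q ^ (n ∸ k) ∸ 1) (gauss q n k) (den k)) ⟩
    (q ^ (n ∸ k) ∸ 1) * gauss q n k * den k       ≡⟨ cong (_* den k) (*-comm (q ^ (n ∸ k) ∸ 1) (gauss q n k)) ⟩
    gauss q n k * (q ^ (n ∸ k) ∸ 1) * den k       ∎)
    where open ≡-Reasoning

  gauss[1+n]-ratio : k ≤ n → gauss q (suc n) k * (q ^ (suc n ∸ k) ∸ 1) ≡ gauss q n k * (q ^ suc n ∸ 1)
  gauss[1+n]-ratio {k} {n} k≤n = *-cancelʳ-≡ _ _ (den k) {{den-nonZero k}} (begin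
    gauss q (suc n) k * (q ^ (suc n ∸ k) ∸ 1) * den k    ≡⟨ rearrange (gauss q (suc n) k) _ (den k) ⟩
    (q ^ (suc n ∸ k) ∸ 1) * (gauss q (suc n) k * den k)  ≡⟨ cong ((q ^ (suc n ∸ k) ∸ 1) *_) (gauss*den≡num (m≤n⇒m≤1+n k≤n)) ⟩
    (q ^ (suc n ∸ k) ∸ 1) * num (suc n ∸ k) k            ≡⟨ cong (λ u → (q ^ u ∸ 1) * num u k) (+-∸-assoc 1 k≤n) ⟩
    (q ^ suc a ∸ 1) * num (suc a) k                      ≡⟨ sym (num-unshift a k) ⟩
    num a k * (q ^ (a + suc k) ∸ 1)                      ≡⟨ cong (λ u → num a k * (q ^ u ∸ 1)) a+[1+k]≡1+n ⟩
    num a k * (q ^ suc n ∸ 1)                            ≡⟨ cong (_* (q ^ suc n ∸ 1)) (sym (gauss*den≡num k≤n)) ⟩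
    gauss q n k * den k * (q ^ suc n ∸ 1)                ≡⟨ *-assoc (gauss q n k) _ _ ⟩
    gauss q n k * (den k * (q ^ suc n ∸ 1))              ≡⟨ cong (gauss q n k *_) (*-comm (den k) _) ⟩
    gauss q n k * ((q ^ suc n ∸ 1) * den k)              ≡⟨ sym (*-assoc (gauss q n k) _ _) ⟩
    gauss q n k * (q ^ suc n ∸ 1) * den k                ∎)
    where
    open ≡-Reasoning
    a : ℕ
    a = n ∸ k
    a+[1+k]≡1+n : a + suc k ≡ suc n
    a+[1+k]≡1+n = trans (+-suc a k) (cong suc (m∸n+n≡m k≤n))
    rearrange : ∀ x y z → x * y * z ≡ y * (x * z)
    rearrange = solve-∀

  num-lower : ∀ a k → q ^ (k * a) * den k ≤ num a k
  num-lower a zero    = ≤-refl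
  num-lower a (suc k) = begin
    q ^ (a + k * a) * (den k * (X ∸ 1))          ≡⟨ cong (_* (den k * (X ∸ 1))) (^-distribˡ-+-* q a (k * a)) ⟩
    q ^ a * q ^ (k * a) * (den k * (X ∸ 1))      ≡⟨ rearrange (q ^ a) (q ^ (k * a)) (den k) (X ∸ 1) ⟩
    q ^ (k * a) * den k * (q ^ a * (X ∸ 1))      ≤⟨ *-mono-≤ (num-lower a k) factor-lower ⟩
    num a k * (q ^ (a + suc k) ∸ 1)              ∎
    where
    open ≤-Reasoning
    X : ℕ
    X = q ^ suc k
    rearrange : ∀ u v w z → u * v * (w * z) ≡ v * w * (u * z)
    rearrange = solve-∀
    factor-lower : q ^ a * (X ∸ 1) ≤ q ^ (a + suc k) ∸ 1
    factor-lower = begin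
      q ^ a * (X ∸ 1)        ≡⟨ *-distribˡ-∸ (q ^ a) X 1 ⟩
      q ^ a * X ∸ q ^ a * 1  ≤⟨ ∸-monoʳ-≤ (q ^ a * X) (subst (1 ≤_) (sym (*-identityʳ (q ^ a))) (q^n>0 a)) ⟩
      q ^ a * X ∸ 1          ≡⟨ cong (_∸ 1) (sym (^-distribˡ-+-* q a (suc k))) ⟩
      q ^ (a + suc k) ∸ 1    ∎

  num-upper : ∀ a k → num a k ≤ q ^ (k * a) * qPowProd k
  num-upper a zero    = ≤-refl
  num-upper a (suc k) = begin
    num a k * (q ^ (a + suc k) ∸ 1)                  ≤⟨ *-mono-≤ (num-upper a k) (m∸n≤m _ 1) ⟩
    q ^ (k * a) * qPowProd k * q ^ (a + suc k)       ≡⟨ cong (q ^ (k * a) * qPowProd k *_) (^-distribˡ-+-* q a (suc k)) ⟩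
    q ^ (k * a) * qPowProd k * (q ^ a * q ^ suc k)   ≡⟨ rearrange (q ^ (k * a)) (qPowProd k) (q ^ a) (q ^ suc k) ⟩
    q ^ a * q ^ (k * a) * (qPowProd k * q ^ suc k)   ≡⟨ cong (_* (qPowProd k * q ^ suc k)) (sym (^-distribˡ-+-* q a (k * a))) ⟩
    q ^ (a + k * a) * (qPowProd k * q ^ suc k)       ∎
    where
    open ≤-Reasoning
    rearrange : ∀ u v w z → u * v * (w * z) ≡ w * u * (v * z)
    rearrange = solve-∀

module LargeQ (q : ℕ) (3≤q : 3 ≤ q) where

  open GaussianBinomial q (≤-trans (s≤s (s≤s z≤n)) 3≤q) public

  -- The invariant qPowProd k / den k ≤ 2 q^k / (q^k + 1) keeps the product of the factors q^t / (q^t - 1) below 2.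
  qPowProd*[q^k+1]≤2*q^k*den : ∀ k → qPowProd k * (q ^ k + 1) ≤ 2 * q ^ k * den k
  qPowProd*[q^k+1]≤2*q^k*den zero    = ≤-refl
  qPowProd*[q^k+1]≤2*q^k*den (suc k) = begin
    P * X * (X + 1)           ≡⟨ rearrange₁ P X (X + 1) ⟩
    X * (P * (X + 1))         ≤⟨ *-monoʳ-≤ X next-factor ⟩
    X * (2 * den k * (X ∸ 1)) ≡⟨ rearrange₂ X (den k) (X ∸ 1) ⟩
    2 * X * (den k * (X ∸ 1)) ∎
    where
    open ≤-Reasoning
    x X P : ℕ
    x = q ^ k
    X = q ^ suc k
    P = qPowProd k
    rearrange₁ : ∀ u v w → u * v * w ≡ v * (u * w)
    rearrange₁ = solve-∀
    rearrange₂ : ∀ u v w → u * (2 * v * w) ≡ 2 * u * (v * w)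
    rearrange₂ = solve-∀
    rearrange₃ : ∀ u v w → u * v * w ≡ u * (w * v)
    rearrange₃ = solve-∀
    rearrange₄ : ∀ u v w → 2 * u * v * w ≡ 2 * v * w * u
    rearrange₄ = solve-∀
    next-factor : P * (X + 1) ≤ 2 * den k * (X ∸ 1)
    next-factor = *-cancelʳ-≤ _ _ x {{>-nonZero (q^n>0 k)}} (begin
      P * (X + 1) * x               ≡⟨ rearrange₃ P (X + 1) x ⟩
      P * (x * (X + 1))             ≤⟨ *-monoʳ-≤ P (x*[X+1]≤[x+1]*[X∸1] (q^n>0 k) (*-monoˡ-≤ x 3≤q)) ⟩
      P * ((x + 1) * (X ∸ 1))       ≡⟨ sym (*-assoc P (x + 1) (X ∸ 1)) ⟩
      P * (x + 1) * (X ∸ 1)         ≤⟨ *-monoˡ-≤ (X ∸ 1) (qPowProd*[q^k+1]≤2*q^k*den k) ⟩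
      2 * x * den k * (X ∸ 1)       ≡⟨ rearrange₄ x (den k) (X ∸ 1) ⟩
      2 * den k * (X ∸ 1) * x       ∎)

  qPowProd<2*den : ∀ k → qPowProd k < 2 * den k
  qPowProd<2*den k = *-cancelʳ-< (q ^ k) _ _ (begin-strict
    qPowProd k * q ^ k        <⟨ *-monoʳ-< (qPowProd k) {{>-nonZero (qPowProd>0 k)}} (n<1+n (q ^ k)) ⟩
    qPowProd k * suc (q ^ k)  ≡⟨ cong (qPowProd k *_) (+-comm 1 (q ^ k)) ⟩
    qPowProd k * (q ^ k + 1)  ≤⟨ qPowProd*[q^k+1]≤2*q^k*den k ⟩
    2 * q ^ k * den k         ≡⟨ rearrange (q ^ k) (den k) ⟩
    2 * den k * q ^ k         ∎)
    where
    open ≤-Reasoning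
    rearrange : ∀ u v → 2 * u * v ≡ 2 * v * u
    rearrange = solve-∀
    qPowProd>0 : ∀ k → 0 < qPowProd k
    qPowProd>0 zero    = z<s
    qPowProd>0 (suc k) = *-mono-≤ (qPowProd>0 k) (q^n>0 (suc k))

  gauss-bounds : k ≤ n → PowerBracket (k * (n ∸ k)) (gauss q n k)
  gauss-bounds {k} {n} k≤n = lower , upper
    where
    open ≤-Reasoning
    lower : q ^ (k * (n ∸ k)) ≤ gauss q n k
    lower = *-cancelʳ-≤ _ _ (den k) {{den-nonZero k}} (begin
      q ^ (k * (n ∸ k)) * den k  ≤⟨ num-lower (n ∸ k) k ⟩
      num (n ∸ k) k              ≡⟨ sym (gauss*den≡num k≤n) ⟩
      gauss q n k * den k        ∎)
    upper : gauss q n k < 2 * q ^ (k * (n ∸ k))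
    upper = *-cancelʳ-< (den k) _ _ (begin-strict
      gauss q n k * den k                   ≡⟨ gauss*den≡num k≤n ⟩
      num (n ∸ k) k                         ≤⟨ num-upper (n ∸ k) k ⟩
      q ^ (k * (n ∸ k)) * qPowProd k        <⟨ *-monoʳ-< (q ^ (k * (n ∸ k))) {{>-nonZero (q^n>0 (k * (n ∸ k)))}} (qPowProd<2*den k) ⟩
      q ^ (k * (n ∸ k)) * (2 * den k)       ≡⟨ rearrange (q ^ (k * (n ∸ k))) (den k) ⟩
      2 * q ^ (k * (n ∸ k)) * den k         ∎)
      where
      rearrange : ∀ u v → u * (2 * v) ≡ 2 * u * v
      rearrange = solve-∀

  gauss>0 : k ≤ n → 0 < gauss q n k
  gauss>0 {k} {n} k≤n = ≤-trans (q^n>0 (k * (n ∸ k))) (proj₁ (gauss-bounds k≤n))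

  2*q^r≤3*[q^r∸1] : ∀ r → 0 < r → 2 * q ^ r ≤ 3 * (q ^ r ∸ 1)
  2*q^r≤3*[q^r∸1] (suc r) _ = 2*y≤3*[y∸1] (≤-trans 3≤q (m≤m*n q (q ^ r) {{>-nonZero (q^n>0 r)}}))
    where
    2*y≤3*[y∸1] : ∀ {y} → 3 ≤ y → 2 * y ≤ 3 * (y ∸ 1)
    2*y≤3*[y∸1] {suc y} (s≤s 2≤y) = subst (_≤ 3 * y) (sym (*-suc 2 y)) (+-monoˡ-≤ (2 * y) 2≤y)

  [q^b∸1]*[q^c∸1]<q^[b+c] : ∀ b c → (q ^ b ∸ 1) * (q ^ c ∸ 1) < q ^ (b + c)
  [q^b∸1]*[q^c∸1]<q^[b+c] b c = begin-strict
    (q ^ b ∸ 1) * (q ^ c ∸ 1)  ≤⟨ *-monoʳ-≤ (q ^ b ∸ 1) (m∸n≤m (q ^ c) 1) ⟩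
    (q ^ b ∸ 1) * q ^ c        <⟨ *-monoˡ-< (q ^ c) {{>-nonZero (q^n>0 c)}} (∸-monoʳ-< z<s (q^n>0 b)) ⟩
    q ^ b * q ^ c              ≡⟨ sym (^-distribˡ-+-* q b c) ⟩
    q ^ (b + c)                ∎
    where open ≤-Reasoning

  -- The two subtracted ones cost at most a factor (2/3)², which one spare power of q ≥ 3 absorbs.
  4*q^a*[q^b∸1]*[q^c∸1]<3*q^E*[q^r∸1]*[q^s∸1] : ∀ {a b c E r s} → 0 < r → 0 < s → a + b + c < E + r + s →
    4 * q ^ a * (q ^ b ∸ 1) * (q ^ c ∸ 1) < 3 * q ^ E * (q ^ r ∸ 1) * (q ^ s ∸ 1)
  4*q^a*[q^b∸1]*[q^c∸1]<3*q^E*[q^r∸1]*[q^s∸1] {a} {b} {c} {E} {r} {s} 0<r 0<s exponents = *-cancelˡ-< 9 _ _ (begin-strict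
    9 * (4 * q ^ a * (q ^ b ∸ 1) * (q ^ c ∸ 1))      ≡⟨ regroup₁ (q ^ a) (q ^ b ∸ 1) (q ^ c ∸ 1) ⟩
    36 * q ^ a * ((q ^ b ∸ 1) * (q ^ c ∸ 1))         <⟨ *-monoʳ-< (36 * q ^ a) {{>-nonZero (*-mono-≤ (s≤s (z≤n {35})) (q^n>0 a))}}
                                                          ([q^b∸1]*[q^c∸1]<q^[b+c] b c) ⟩
    36 * q ^ a * q ^ (b + c)                         ≡⟨ regroup₂ (q ^ a) (q ^ (b + c)) ⟩
    12 * (3 * (q ^ a * q ^ (b + c)))                 ≡⟨ cong (λ x → 12 * (3 * x)) (sym (^-distribˡ-+-* q a (b + c))) ⟩
    12 * (3 * q ^ (a + (b + c)))                     ≤⟨ *-monoʳ-≤ 12 (*-monoˡ-≤ (q ^ (a + (b + c))) 3≤q) ⟩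
    12 * q ^ suc (a + (b + c))                       ≡⟨ cong (λ x → 12 * q ^ suc x) (sym (+-assoc a b c)) ⟩
    12 * q ^ suc (a + b + c)                         ≤⟨ *-monoʳ-≤ 12 (^-monoʳ-≤ q exponents) ⟩
    12 * q ^ (E + r + s)                             ≡⟨ cong (12 *_) (trans (^-distribˡ-+-* q (E + r) s) (cong (_* q ^ s) (^-distribˡ-+-* q E r))) ⟩
    12 * (q ^ E * q ^ r * q ^ s)                     ≡⟨ regroup₃ (q ^ E) (q ^ r) (q ^ s) ⟩
    3 * q ^ E * (2 * q ^ r) * (2 * q ^ s)            ≤⟨ *-mono-≤ (*-monoʳ-≤ (3 * q ^ E) (2*q^r≤3*[q^r∸1] r 0<r)) (2*q^r≤3*[q^r∸1] s 0<s) ⟩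
    3 * q ^ E * (3 * (q ^ r ∸ 1)) * (3 * (q ^ s ∸ 1)) ≡⟨ regroup₄ (q ^ E) (q ^ r ∸ 1) (q ^ s ∸ 1) ⟩
    9 * (3 * q ^ E * (q ^ r ∸ 1) * (q ^ s ∸ 1))       ∎)
    where
    open ≤-Reasoning
    regroup₁ : ∀ x y z → 9 * (4 * x * y * z) ≡ 36 * x * (y * z)
    regroup₁ = solve-∀
    regroup₂ : ∀ x y → 36 * x * y ≡ 12 * (3 * (x * y))
    regroup₂ = solve-∀
    regroup₃ : ∀ x y z → 12 * (x * y * z) ≡ 3 * x * (2 * y) * (2 * z)
    regroup₃ = solve-∀
    regroup₄ : ∀ x y z → 3 * x * (3 * y) * (3 * z) ≡ 9 * (3 * x * y * z)
    regroup₄ = solve-∀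

sumℤ0-vanishing-tail : ∀ {f : ℕ → ℤ} m t → (∀ h → m < h → h ≤ t + m → f h ≡ ℤ.0ℤ) → sumℤ0 f (t + m) ≡ sumℤ0 f m
sumℤ0-vanishing-tail         m zero    _      = refl
sumℤ0-vanishing-tail {f = f} m (suc t) f≡0 = begin
  sumℤ0 f (t + m) ℤ.+ f (suc (t + m))  ≡⟨ cong (λ y → sumℤ0 f (t + m) ℤ.+ y) (f≡0 (suc (t + m)) (s≤s (m≤n+m m t)) ≤-refl) ⟩
  sumℤ0 f (t + m) ℤ.+ ℤ.0ℤ             ≡⟨ ℤ.+-identityʳ (sumℤ0 f (t + m)) ⟩
  sumℤ0 f (t + m)                      ≡⟨ sumℤ0-vanishing-tail m t (λ h m<h h≤t+m → f≡0 h m<h (m≤n⇒m≤1+n h≤t+m)) ⟩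
  sumℤ0 f m                            ∎
  where open ≡-Reasoning

sign : ℕ → ℤ
sign x = -[1+ 0 ] ℤ.^ x

∣sign*+n∣≡n : ∀ x n → ∣ sign x ℤ.* ℤ.+ n ∣ ≡ n
∣sign*+n∣≡n zero    n = ℤ.abs-* (ℤ.+ 1) (ℤ.+ n) ∙ *-identityˡ n
  where _∙_ = trans
∣sign*+n∣≡n (suc x) n = begin
  ∣ -[1+ 0 ] ℤ.* sign x ℤ.* ℤ.+ n ∣   ≡⟨ cong ∣_∣ (ℤ.*-assoc -[1+ 0 ] (sign x) (ℤ.+ n)) ⟩
  ∣ -[1+ 0 ] ℤ.* (sign x ℤ.* ℤ.+ n) ∣ ≡⟨ ℤ.abs-* -[1+ 0 ] (sign x ℤ.* ℤ.+ n) ⟩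
  1 * ∣ sign x ℤ.* ℤ.+ n ∣            ≡⟨ *-identityˡ _ ⟩
  ∣ sign x ℤ.* ℤ.+ n ∣                ≡⟨ ∣sign*+n∣≡n x n ⟩
  n                                    ∎
  where open ≡-Reasoning

module AlternatingSum (j : ℕ) (T : ℕ → ℕ) where

  altTerm : ℕ → ℤ
  altTerm h = sign (j ∸ h) ℤ.* ℤ.+ T h

  -- |altTerm 0 + ... + altTerm n|, valid while T is nondecreasing on [0, n].
  alternant : ℕ → ℕ
  alternant zero    = T 0
  alternant (suc n) = T (suc n) ∸ alternant n

  alternant≤T : ∀ n → alternant n ≤ T n
  alternant≤T zero    = ≤-refl
  alternant≤T (suc n) = m∸n≤m (T (suc n)) (alternant n)

  T≤alternant+T : ∀ n → T (suc n) ≤ alternant (suc n) + T n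
  T≤alternant+T n = begin
    T (suc n)                                ≤⟨ m≤n+m∸n (T (suc n)) (alternant n) ⟩
    alternant n + alternant (suc n)          ≤⟨ +-monoˡ-≤ _ (alternant≤T n) ⟩
    T n + alternant (suc n)                  ≡⟨ +-comm (T n) _ ⟩
    alternant (suc n) + T n                  ∎
    where open ≤-Reasoning

  sumℤ0-altTerm : ∀ n → n ≤ j → (∀ p → p < n → T p ≤ T (suc p)) →
                  sumℤ0 altTerm n ≡ sign (j ∸ n) ℤ.* ℤ.+ alternant n
  sumℤ0-altTerm zero    _   _    = refl
  sumℤ0-altTerm (suc n) n<j mono = begin
    sumℤ0 altTerm n ℤ.+ altTerm (suc n)
      ≡⟨ cong (λ y → y ℤ.+ altTerm (suc n)) (sumℤ0-altTerm n (<⇒≤ n<j) (λ p p<n → mono p (m<n⇒m<1+n p<n))) ⟩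
    sign (j ∸ n) ℤ.* ℤ.+ A ℤ.+ sign x ℤ.* ℤ.+ T (suc n)
      ≡⟨ cong (λ y → sign y ℤ.* ℤ.+ A ℤ.+ sign x ℤ.* ℤ.+ T (suc n)) (+-∸-assoc 1 n<j) ⟩
    ℤ.- ℤ.1ℤ ℤ.* sign x ℤ.* ℤ.+ A ℤ.+ sign x ℤ.* ℤ.+ T (suc n)
      ≡⟨ flip-sign (sign x) (ℤ.+ A) (ℤ.+ T (suc n)) ⟩
    sign x ℤ.* (ℤ.+ T (suc n) ℤ.- ℤ.+ A)
      ≡⟨ cong (sign x ℤ.*_) (trans (ℤ.m-n≡m⊖n (T (suc n)) A) (ℤ.⊖-≥ A≤T[1+n])) ⟩
    sign x ℤ.* ℤ.+ alternant (suc n) ∎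
    where
    open ≡-Reasoning
    x A : ℕ
    x = j ∸ suc n
    A = alternant n
    A≤T[1+n] : A ≤ T (suc n)
    A≤T[1+n] = ≤-trans (alternant≤T n) (mono n ≤-refl)
    flip-sign : ∀ s u t → ℤ.- ℤ.1ℤ ℤ.* s ℤ.* u ℤ.+ s ℤ.* t ≡ s ℤ.* (t ℤ.- u)
    flip-sign = ℤ-Solver.solve-∀

  T<4*alternant : ∀ m → (∀ n → n < m → 4 * T n < 3 * T (suc n)) → 0 < T m → T m < 4 * alternant m
  T<4*alternant zero    _     T0>0 = subst (T 0 <_) (*-comm (T 0) 4) (m<m*n (T 0) 4 {{>-nonZero T0>0}} (s≤s (s≤s z≤n)))
  T<4*alternant (suc p) ratio _ = +-cancelʳ-< (3 * T (suc p)) (T (suc p)) (4 * alternant (suc p)) (begin-strict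
    T (suc p) + 3 * T (suc p)                 ≡⟨ four-times (T (suc p)) ⟩
    4 * T (suc p)                             ≤⟨ *-monoʳ-≤ 4 (T≤alternant+T p) ⟩
    4 * (alternant (suc p) + T p)             ≡⟨ *-distribˡ-+ 4 (alternant (suc p)) (T p) ⟩
    4 * alternant (suc p) + 4 * T p           <⟨ +-monoʳ-< (4 * alternant (suc p)) (ratio p ≤-refl) ⟩
    4 * alternant (suc p) + 3 * T (suc p)     ∎)
    where
    open ≤-Reasoning
    four-times : ∀ x → x + 3 * x ≡ 4 * x
    four-times = solve-∀

  alternating-sum-bounds : ∀ m → m ≤ j → (∀ n → n < m → 4 * T n < 3 * T (suc n)) →
    (∀ h → m < h → h ≤ j → T h ≡ 0) → 0 < T m →
    T m < 4 * ∣ sumℤ0 altTerm j ∣ × ∣ sumℤ0 altTerm j ∣ ≤ T m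
  alternating-sum-bounds m m≤j ratio vanish Tm>0 =
    subst (λ a → T m < 4 * a × a ≤ T m) (sym ∣sum∣≡alternant) (T<4*alternant m ratio Tm>0 , alternant≤T m)
    where
    mono : ∀ p → p < m → T p ≤ T (suc p)
    mono p p<m = <⇒≤ (*-cancelˡ-< 4 (T p) (T (suc p)) (<-≤-trans (ratio p p<m) (*-monoˡ-≤ (T (suc p)) (n≤1+n 3))))
    sum≡sum-upto-m : sumℤ0 altTerm j ≡ sumℤ0 altTerm m
    sum≡sum-upto-m = trans (cong (sumℤ0 altTerm) (sym (m∸n+n≡m m≤j)))
      (sumℤ0-vanishing-tail m (j ∸ m)
        (λ h m<h h≤ → trans (cong (λ t → sign (j ∸ h) ℤ.* ℤ.+ t) (vanish h m<h (subst (h ≤_) (m∸n+n≡m m≤j) h≤)))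
                            (ℤ.*-zeroʳ (sign (j ∸ h)))))
    ∣sum∣≡alternant : ∣ sumℤ0 altTerm j ∣ ≡ alternant m
    ∣sum∣≡alternant = trans (cong ∣_∣ (trans sum≡sum-upto-m (sumℤ0-altTerm m m≤j mono))) (∣sign*+n∣≡n (j ∸ m) (alternant m))

module BTerm (q : ℕ) (3≤q : 3 ≤ q) (d e i j : ℕ) where

  open LargeQ q 3≤q

  term : ℕ → ℕ
  term h = q ^ (e * h + (j ∸ h) C 2) * gauss q (d ∸ h) (d ∸ j) * gauss q (d ∸ i) h

  term-vanish : ∀ {h} → d ∸ i < h → term h ≡ 0
  term-vanish {h} d∸i<h =
    trans (cong (q ^ (e * h + (j ∸ h) C 2) * gauss q (d ∸ h) (d ∸ j) *_) (gauss-vanish d∸i<h))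
      (*-zeroʳ (q ^ (e * h + (j ∸ h) C 2) * gauss q (d ∸ h) (d ∸ j)))

  commonFactor : ℕ → ℕ
  commonFactor k = q ^ (e * k + (j ∸ suc k) C 2) * gauss q (d ∸ suc k) (d ∸ j) * gauss q (d ∸ i) k

  term*[q^[j∸k]∸1] : ∀ {k} → k < j → j ≤ d → term k * (q ^ (j ∸ k) ∸ 1) ≡ commonFactor k * (q ^ (j ∸ suc k) * (q ^ (d ∸ k) ∸ 1))
  term*[q^[j∸k]∸1] {k} k<j j≤d = begin
    q ^ x * A * G * X                   ≡⟨ regroup₁ (q ^ x) A G X ⟩
    q ^ x * (A * X) * G                 ≡⟨ cong₂ (λ u v → q ^ u * v * G) x≡y+α gauss-shift ⟩
    q ^ (y + α) * (A′ * Z) * G          ≡⟨ cong (λ u → u * (A′ * Z) * G) (^-distribˡ-+-* q y α) ⟩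
    q ^ y * q ^ α * (A′ * Z) * G        ≡⟨ regroup₂ (q ^ y) (q ^ α) A′ Z G ⟩
    q ^ y * A′ * G * (q ^ α * Z)        ∎
    where
    open ≡-Reasoning
    α N p x y A A′ G X Z : ℕ
    α = j ∸ suc k
    N = d ∸ suc k
    p = d ∸ j
    x = e * k + (j ∸ k) C 2
    y = e * k + α C 2
    A = gauss q (d ∸ k) p
    A′ = gauss q N p
    G = gauss q (d ∸ i) k
    X = q ^ (j ∸ k) ∸ 1
    Z = q ^ (d ∸ k) ∸ 1
    x≡y+α : x ≡ y + α
    x≡y+α = begin
      e * k + (j ∸ k) C 2    ≡⟨ cong (λ u → e * k + u C 2) (+-∸-assoc 1 k<j) ⟩
      e * k + suc α C 2      ≡⟨ cong (e * k +_) ([1+n]C2≡n+nC2 α) ⟩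
      e * k + (α + α C 2)    ≡⟨ regroup (e * k) α (α C 2) ⟩
      e * k + α C 2 + α      ∎
      where
      regroup : ∀ u v w → u + (v + w) ≡ u + w + v
      regroup = solve-∀
    d∸k≡1+N : d ∸ k ≡ suc N
    d∸k≡1+N = +-∸-assoc 1 (<-≤-trans k<j j≤d)
    gauss-shift : A * X ≡ A′ * Z
    gauss-shift = begin
      gauss q (d ∸ k) p * (q ^ (j ∸ k) ∸ 1)          ≡⟨ cong₂ (λ u v → gauss q u p * (q ^ v ∸ 1)) d∸k≡1+N
                                                          (sym (trans (cong (_∸ p) (sym d∸k≡1+N)) (d∸k∸[d∸j]≡j∸k (<⇒≤ k<j) j≤d))) ⟩
      gauss q (suc N) p * (q ^ (suc N ∸ p) ∸ 1)      ≡⟨ gauss[1+n]-ratio (∸-monoʳ-≤ d k<j) ⟩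
      gauss q N p * (q ^ suc N ∸ 1)                  ≡⟨ cong (λ u → A′ * (q ^ u ∸ 1)) (sym d∸k≡1+N) ⟩
      gauss q N p * (q ^ (d ∸ k) ∸ 1)                ∎
    regroup₁ : ∀ u a g x → u * a * g * x ≡ u * (a * x) * g
    regroup₁ = solve-∀
    regroup₂ : ∀ u v a z g → u * v * (a * z) * g ≡ u * a * g * (v * z)
    regroup₂ = solve-∀

  term[1+k]*[q^[1+k]∸1] : ∀ {k} → k < d ∸ i → term (suc k) * (q ^ suc k ∸ 1) ≡ commonFactor k * (q ^ e * (q ^ (d ∸ i ∸ k) ∸ 1))
  term[1+k]*[q^[1+k]∸1] {k} k<d∸i = begin
    q ^ (e * suc k + c) * A′ * H * Y          ≡⟨ *-assoc (q ^ (e * suc k + c) * A′) H Y ⟩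
    q ^ (e * suc k + c) * A′ * (H * Y)        ≡⟨ cong₂ (λ u v → q ^ u * A′ * v) exponent (gauss[1+k]-ratio (<⇒≤ k<d∸i)) ⟩
    q ^ (e + y) * A′ * (G * W)                ≡⟨ cong (λ u → u * A′ * (G * W)) (^-distribˡ-+-* q e y) ⟩
    q ^ e * q ^ y * A′ * (G * W)              ≡⟨ regroup (q ^ e) (q ^ y) A′ G W ⟩
    q ^ y * A′ * G * (q ^ e * W)              ∎
    where
    open ≡-Reasoning
    c y A′ G H Y W : ℕ
    c = (j ∸ suc k) C 2
    y = e * k + c
    A′ = gauss q (d ∸ suc k) (d ∸ j)
    G = gauss q (d ∸ i) k
    H = gauss q (d ∸ i) (suc k)
    Y = q ^ suc k ∸ 1
    W = q ^ (d ∸ i ∸ k) ∸ 1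
    exponent : e * suc k + c ≡ e + y
    exponent = trans (cong (_+ c) (*-suc e k)) (+-assoc e (e * k) c)
    regroup : ∀ u v a g w → u * v * a * (g * w) ≡ v * a * g * (u * w)
    regroup = solve-∀

  term-ratio : ∀ {k} → d ≤ e → j ≤ d → k < j → k < d ∸ i → 4 * term k < 3 * term (suc k)
  term-ratio {k} d≤e j≤d k<j k<d∸i = *-cancelʳ-< (X * Y) _ _ (begin-strict
    4 * term k * (X * Y)                  ≡⟨ regroup₁ (term k) X Y ⟩
    4 * (term k * X) * Y                  ≡⟨ cong (λ t → 4 * t * Y) (term*[q^[j∸k]∸1] k<j j≤d) ⟩
    4 * (S * (q ^ α * Z)) * Y             ≡⟨ regroup₂ S (q ^ α) Z Y ⟩
    S * (4 * q ^ α * Z * Y)               <⟨ *-monoʳ-< S {{>-nonZero S>0}} (4*q^a*[q^b∸1]*[q^c∸1]<3*q^E*[q^r∸1]*[q^s∸1] {α} {d ∸ k} {suc k} {e} j∸k>0 d∸i∸k>0 exponents) ⟩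
    S * (3 * q ^ e * X * W)               ≡⟨ regroup₃ S (q ^ e) X W ⟩
    3 * (S * (q ^ e * W)) * X             ≡⟨ cong (λ t → 3 * t * X) (sym (term[1+k]*[q^[1+k]∸1] k<d∸i)) ⟩
    3 * (term (suc k) * Y) * X            ≡⟨ regroup₄ (term (suc k)) Y X ⟩
    3 * term (suc k) * (X * Y)            ∎)
    where
    open ≤-Reasoning
    α S X Y Z W : ℕ
    α = j ∸ suc k
    S = commonFactor k
    X = q ^ (j ∸ k) ∸ 1
    Y = q ^ suc k ∸ 1
    Z = q ^ (d ∸ k) ∸ 1
    W = q ^ (d ∸ i ∸ k) ∸ 1
    j∸k>0 : 0 < j ∸ k
    j∸k>0 = m<n⇒0<n∸m k<j
    d∸i∸k>0 : 0 < d ∸ i ∸ k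
    d∸i∸k>0 = m<n⇒0<n∸m k<d∸i
    S>0 : 0 < S
    S>0 = *-mono-≤ (*-mono-≤ (q^n>0 (e * k + α C 2)) (gauss>0 (∸-monoʳ-≤ d k<j))) (gauss>0 (<⇒≤ k<d∸i))
    exponents : α + (d ∸ k) + suc k < e + (j ∸ k) + (d ∸ i ∸ k)
    exponents = begin-strict
      α + (d ∸ k) + suc k          ≡⟨ regroup α (d ∸ k) k ⟩
      d ∸ k + k + suc α            ≡⟨ cong₂ _+_ (m∸n+n≡m (<⇒≤ (<-≤-trans k<j j≤d))) (sym (+-∸-assoc 1 k<j)) ⟩
      d + (j ∸ k)                  ≡⟨ sym (+-identityʳ (d + (j ∸ k))) ⟩
      d + (j ∸ k) + 0              <⟨ +-mono-≤-< (+-monoˡ-≤ (j ∸ k) d≤e) d∸i∸k>0 ⟩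
      e + (j ∸ k) + (d ∸ i ∸ k)    ∎
      where
      regroup : ∀ a x k → a + x + suc k ≡ x + k + suc a
      regroup = solve-∀
    regroup₁ : ∀ t x y → 4 * t * (x * y) ≡ 4 * (t * x) * y
    regroup₁ = solve-∀
    regroup₂ : ∀ s u z y → 4 * (s * (u * z)) * y ≡ s * (4 * u * z * y)
    regroup₂ = solve-∀
    regroup₃ : ∀ s u x w → s * (3 * u * x * w) ≡ 3 * (s * (u * w)) * x
    regroup₃ = solve-∀
    regroup₄ : ∀ t y x → 3 * (t * y) * x ≡ 3 * t * (x * y)
    regroup₄ = solve-∀

  term-bounds-at-j : i ≤ d → d ≤ e → 0 < j → j ≤ d ∸ i → PowerBracket (b d e j i j) (term j)
  term-bounds-at-j i≤d d≤e 0<j j≤d∸i =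
    subst₂ PowerBracket (exponent-at-j i≤d d≤e 0<j j≤d∸i) (sym term-j≡)
      (q^x*-bracket x (gauss-bounds j≤d∸i))
    where
    x : ℕ
    x = e * j + (j ∸ j) C 2
    term-j≡ : term j ≡ q ^ x * gauss q (d ∸ i) j
    term-j≡ = cong (_* gauss q (d ∸ i) j) (trans (cong (q ^ x *_) (gauss-diag (d ∸ j))) (*-identityʳ (q ^ x)))

  term-bounds-at-d∸i : i ≤ d → d ≤ e → j ≤ d → d ∸ i < j → PowerBracket (b d e (d ∸ i) i j) (term (d ∸ i))
  term-bounds-at-d∸i i≤d d≤e j≤d d∸i<j =
    subst₂ PowerBracket (exponent-at-d∸i i≤d d≤e j≤d d∸i<j) (sym term-d∸i≡)
      (q^x*-bracket x (gauss-bounds (∸-monoʳ-≤ d (<⇒≤ d∸i<j))))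
    where
    m x : ℕ
    m = d ∸ i
    x = e * m + (j ∸ m) C 2
    term-d∸i≡ : term m ≡ q ^ x * gauss q (d ∸ m) (d ∸ j)
    term-d∸i≡ = trans (cong (q ^ x * gauss q (d ∸ m) (d ∸ j) *_) (gauss-diag m)) (*-identityʳ _)

  term-bounds-at-hmax : i ≤ d → d ≤ e → 0 < j → j ≤ d → PowerBracket (b d e (hmax d i j) i j) (term (hmax d i j))
  term-bounds-at-hmax i≤d d≤e 0<j j≤d with j ≤? d ∸ i
  ... | yes j≤d∸i = subst (λ h → PowerBracket (b d e h i j) (term h)) (sym (m≤n⇒m⊓n≡m j≤d∸i))
                      (term-bounds-at-j i≤d d≤e 0<j j≤d∸i)
  ... | no  j≰d∸i = subst (λ h → PowerBracket (b d e h i j) (term h)) (sym (m≥n⇒m⊓n≡n (<⇒≤ (≰⇒> j≰d∸i))))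
                      (term-bounds-at-d∸i i≤d d≤e j≤d (≰⇒> j≰d∸i))

lemma4p2 : (q d e i j : ℕ) → IsPrimePower q → 3 ≤ q →
    1 ≤ d → d ≤ e → i ≤ d → 1 ≤ j → j ≤ d →
    q ^ b d e (hmax d i j) i j < 4 * ∣ B q d e j i ∣ ×
    ∣ B q d e j i ∣ < 2 * q ^ b d e (hmax d i j) i j
lemma4p2 q d e i j _ 3≤q _ d≤e i≤d 0<j j≤d =
  ≤-<-trans (proj₁ bracket) (proj₁ alternating) , ≤-<-trans (proj₂ alternating) (proj₂ bracket)
  where
  open LargeQ q 3≤q using (PowerBracket; q^n>0)
  open BTerm q 3≤q d e i j
  open AlternatingSum j term
  m : ℕ
  m = hmax d i j
  bracket : PowerBracket (b d e m i j) (term m)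
  bracket = term-bounds-at-hmax i≤d d≤e 0<j j≤d
  ratio : ∀ n → n < m → 4 * term n < 3 * term (suc n)
  ratio n n<m = term-ratio d≤e j≤d (<-≤-trans n<m (m⊓n≤m j (d ∸ i))) (<-≤-trans n<m (m⊓n≤n j (d ∸ i)))
  vanish : ∀ h → m < h → h ≤ j → term h ≡ 0
  vanish h m<h h≤j with d ∸ i <? h
  ... | yes d∸i<h = term-vanish d∸i<h
  ... | no  d∸i≮h = contradiction (⊓-glb h≤j (≮⇒≥ d∸i≮h)) (<⇒≱ m<h)
  alternating : term m < 4 * ∣ B q d e j i ∣ × ∣ B q d e j i ∣ ≤ term m
  alternating = alternating-sum-bounds m (m⊓n≤m j (d ∸ i)) ratio vanish (<-≤-trans (q^n>0 (b d e m i j)) (proj₁ bracket))
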